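{- Let $\alpha,\beta^1,\dots,\beta^m,\gamma^1,\dots,\gamma^r\in\mathrm{ord}$ with $m,r\ge1$. (1) If $\alpha\le\beta^1,\dots,\beta^m$ and $\beta^j\le\gamma^1,\dots,\gamma^r$ for each $j\in\{1,\dots,m\}$, then $\alpha\le\gamma^1,\dots,\gamma^r$. (2) If $\alpha<\beta^1,\dots,\beta^m$ and $\beta^j\le\gamma^1,\dots,\gamma^r$ for each $j$, then $\alpha<\gamma^1,\dots,\gamma^r$. (3) If $\alpha\le\beta^1,\dots,\beta^m$ and $\beta^j<\gamma^1,\dots,\gamma^r$ for each $j$, then $\alpha<\gamma^1,\dots,\gamma^r$.
   Context: The setting is constructive. Let $\mathfrak F$ be a set of index sets containing $\mathbb N$ and every $\mathbb N_k=\{n\in\mathbb N:n<k\}$, closed (up to isomorphism) under finitely enumerated subsets, sets of finitely enumerated subsets, and disjoint unions indexed by elements of $\mathfrak F$. The set $\mathrm{ord}=\mathrm{ord}_{\mathfrak F}$ is defined inductively: a distinguished element $\underline 0$, and for every $I\in\mathfrak F$ and family $(\alpha_i)_{i\in I}$ in $\mathrm{ord}$ an element $\mathrm S(\alpha_i)_{i\in I}$. For $\alpha=\mathrm S(\alpha_i)_{i\in I}$, $\mathrm{In}_\alpha=I$; by convention $\mathrm{In}_{\underline0}=\emptyset$. For a finite list $F\subseteq_f\mathrm{In}_\alpha$, $\alpha_F$ is the list of the $\alpha_i$, $i\in F$. By simultaneous induction ($m\ge1$): $\alpha\le\beta^1,\dots,\beta^m$ means $\alpha_i<\beta^1,\dots,\beta^m$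 for all $i\in\mathrm{In}_\alpha$; $\alpha<\beta^1,\dots,\beta^m$ means there exist finite lists $F_k\subseteq_f\mathrm{In}_{\beta^k}$, not all empty, with $\alpha\le\beta^1_{F_1},\dots,\beta^m_{F_m}$ (the concatenated list). -}

module Defs where

open import Data.Empty using (⊥)
open import Data.Unit using (⊤)
open import Data.Product using (Σ; _×_)
open import Data.Sum using (_⊎_)
open import Data.List using (List; []; _∷_; map; _++_)
open import Relation.Binary.PropositionalEquality using (_≢_)

-- The family 𝔉 of index sets is given as a universe: codes U with decoding El.
-- ord_𝔉 : inductively generated by 0̲ and S(α_i)_{i∈I} for I ∈ 𝔉.
data Ord (U : Set) (El : U → Set) : Set where
  O̲ : Ord U El
  S : (I : U) → (El I → Ord U El) → Ord U El

module _ {U : Set} {El : U → Set} where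

  In : Ord U El → Set
  In O̲ = ⊥
  In (S I f) = El I

  child : (α : Ord U El) → In α → Ord U El
  child O̲ ()
  child (S I f) i = f i

  -- a choice of finite lists F_k ⊆_f In_{β^k}, one for each β^k in the list
  Sel : List (Ord U El) → Set
  Sel [] = ⊤
  Sel (β ∷ βs) = List (In β) × Sel βs

  flatten : (βs : List (Ord U El)) → Sel βs → List (Ord U El)
  flatten [] _ = []
  flatten (β ∷ βs) (F Data.Product., Fs) = map (child β) F ++ flatten βs Fs

  NotAllEmpty : (βs : List (Ord U El)) → Sel βs → Set
  NotAllEmpty [] _ = ⊥
  NotAllEmpty (β ∷ βs) (F Data.Product., Fs) = (F ≢ []) ⊎ NotAllEmpty βs Fs

  -- α ≤ β¹,…,βᵐ : for all i ∈ In_α, α_i < β¹,…,βᵐ  (with < unfolded, see below)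
  _≤*_ : Ord U El → List (Ord U El) → Set
  O̲ ≤* βs = ⊤
  S I f ≤* βs = (i : El I) →
    Σ (Sel βs) (λ Fs → NotAllEmpty βs Fs × (f i ≤* flatten βs Fs))

  _<*_ : Ord U El → List (Ord U El) → Set
  α <* βs = Σ (Sel βs) (λ Fs → NotAllEmpty βs Fs × (α ≤* flatten βs Fs))

{-# OPTIONS --safe #-}
module Submission where

-- The only
-- non-structural step is merging finitely many witnesses βʲ <* γs into a single
-- selection from γs: the union of their selections only enlarges the flattened
-- list, and ≤* is monotone in that list, because a sublist inclusion transports
-- a selection without changing what it flattens to.

open import Defs
open import Data.Product using (_×_; Σ; _,_)
open import Data.List using (List; _∷_; []; map; _++_)
open import Data.List.Relation.Unary.All as All using (All; []; _∷_; tabulate)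
import Data.List.Relation.Unary.All.Properties as Allₚ
open import Data.List.Relation.Binary.Sublist.Propositional using (_⊆_; []; _∷_; _∷ʳ_; ⊆-refl)
open import Data.List.Relation.Binary.Sublist.Propositional.Properties
  using (++⁺; ++⁺ˡ; ++⁺ʳ) renaming (map⁺ to map⁺-⊆)
open import Data.List.Properties using (++-conicalˡ)
open import Data.Empty using (⊥-elim)
open import Function using (_∘_)
open import Data.Sum using (inj₁; inj₂)
open import Data.Unit using (tt)
open import Relation.Binary.PropositionalEquality using (_≡_; _≢_; refl; cong; sym; subst)

module _ {U : Set} {El : U → Set} where

  private
    variable
      α : Ord U El
      βs γs : List (Ord U El)

  emptySel : (βs : List (Ord U El)) → Sel βs
  emptySel [] = tt
  emptySel (β ∷ βs) = [] , emptySel βs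

  union : (βs : List (Ord U El)) → Sel βs → Sel βs → Sel βs
  union [] _ _ = tt
  union (β ∷ βs) (F , Fs) (G , Gs) = F ++ G , union βs Fs Gs

  flatten-unionˡ : ∀ βs Fs Gs → flatten βs Fs ⊆ flatten βs (union βs Fs Gs)
  flatten-unionˡ [] _ _ = []
  flatten-unionˡ (β ∷ βs) (F , Fs) (G , Gs) =
    ++⁺ (map⁺-⊆ (child β) (++⁺ʳ G ⊆-refl)) (flatten-unionˡ βs Fs Gs)

  flatten-unionʳ : ∀ βs Fs Gs → flatten βs Gs ⊆ flatten βs (union βs Fs Gs)
  flatten-unionʳ [] _ _ = []
  flatten-unionʳ (β ∷ βs) (F , Fs) (G , Gs) =
    ++⁺ (map⁺-⊆ (child β) (++⁺ˡ F ⊆-refl)) (flatten-unionʳ βs Fs Gs)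

  NotAllEmpty-unionˡ : ∀ βs Fs Gs → NotAllEmpty βs Fs → NotAllEmpty βs (union βs Fs Gs)
  NotAllEmpty-unionˡ (β ∷ βs) (F , Fs) (G , Gs) (inj₁ F≢[]) = inj₁ (F≢[] ∘ ++-conicalˡ F G)
  NotAllEmpty-unionˡ (β ∷ βs) (F , Fs) (G , Gs) (inj₂ ne) = inj₂ (NotAllEmpty-unionˡ βs Fs Gs ne)

  NotAllEmpty⇒flatten≢[] : (βs : List (Ord U El)) (Fs : Sel βs) →
                           NotAllEmpty βs Fs → flatten βs Fs ≢ []
  NotAllEmpty⇒flatten≢[] (β ∷ βs) (_ ∷ _ , Fs) _ ()
  NotAllEmpty⇒flatten≢[] (β ∷ βs) ([] , Fs) (inj₁ F≢[]) _ = F≢[] refl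
  NotAllEmpty⇒flatten≢[] (β ∷ βs) ([] , Fs) (inj₂ ne) = NotAllEmpty⇒flatten≢[] βs Fs ne

  widen : βs ⊆ γs → Sel βs → Sel γs
  widen [] _ = tt
  widen (γ ∷ʳ p) Fs = [] , widen p Fs
  widen (refl ∷ p) (F , Fs) = F , widen p Fs

  flatten-widen : (p : βs ⊆ γs) (Fs : Sel βs) → flatten γs (widen p Fs) ≡ flatten βs Fs
  flatten-widen [] _ = refl
  flatten-widen (γ ∷ʳ p) Fs = flatten-widen p Fs
  flatten-widen {β ∷ _} (refl ∷ p) (F , Fs) = cong (map (child β) F ++_) (flatten-widen p Fs)

  NotAllEmpty-widen : (p : βs ⊆ γs) {Fs : Sel βs} → NotAllEmpty βs Fs → NotAllEmpty γs (widen p Fs)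
  NotAllEmpty-widen (γ ∷ʳ p) ne = inj₂ (NotAllEmpty-widen p ne)
  NotAllEmpty-widen (refl ∷ p) (inj₁ F≢[]) = inj₁ F≢[]
  NotAllEmpty-widen (refl ∷ p) (inj₂ ne) = inj₂ (NotAllEmpty-widen p ne)

  <*-mono : βs ⊆ γs → α <* βs → α <* γs
  <*-mono {α = α} p (Fs , ne , le) =
    widen p Fs , NotAllEmpty-widen p ne , subst (α ≤*_) (sym (flatten-widen p Fs)) le

  ≤*-mono : βs ⊆ γs → α ≤* βs → α ≤* γs
  ≤*-mono {α = O̲} _ _ = tt
  ≤*-mono {α = S I f} p le i = <*-mono p (le i)

  ≤*⇒child-<* : {β : Ord U El} → β ≤* γs → (i : In β) → child β i <* γs
  ≤*⇒child-<* {β = S I f} le i = le i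

  All-flatten : {P : Ord U El → Set} → All (λ β → (i : In β) → P (child β i)) βs →
                (Fs : Sel βs) → All P (flatten βs Fs)
  All-flatten [] _ = []
  All-flatten (Pβ ∷ Pβs) (F , Fs) =
    Allₚ.++⁺ (Allₚ.map⁺ (tabulate λ {i} _ → Pβ i)) (All-flatten Pβs Fs)

  join-<* : All (_<* γs) βs →
            Σ (Sel γs) λ Fs → (βs ≢ [] → NotAllEmpty γs Fs) × All (_≤* flatten γs Fs) βs
  join-<* {γs} [] = emptySel γs , (λ []≢[] → ⊥-elim ([]≢[] refl)) , []
  join-<* {γs} ((Fs , ne , le) ∷ rest) with join-<* rest
  ... | Gs , _ , les =
    union γs Fs Gs ,
    (λ _ → NotAllEmpty-unionˡ γs Fs Gs ne) ,
    ≤*-mono (flatten-unionˡ γs Fs Gs) le ∷ All.map (≤*-mono (flatten-unionʳ γs Fs Gs)) les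

  mutual
    ≤*-trans : α ≤* βs → All (_≤* γs) βs → α ≤* γs
    ≤*-trans {α = O̲} _ _ = tt
    ≤*-trans {α = S I f} le βs≤γs i = <*-≤*-trans (le i) βs≤γs

    <*-≤*-trans : α <* βs → All (_≤* γs) βs → α <* γs
    <*-≤*-trans {βs = βs} {γs = γs} (Fs , ne , le) βs≤γs =
      ≤*-<*-trans le (NotAllEmpty⇒flatten≢[] βs Fs ne)
        (All-flatten (All.map ≤*⇒child-<* βs≤γs) Fs)

    ≤*-<*-trans : α ≤* βs → βs ≢ [] → All (_<* γs) βs → α <* γs
    ≤*-<*-trans le βs≢[] βs<γs with join-<* βs<γs
    ... | Fs , ne , βs≤Fs = Fs , ne βs≢[] , ≤*-trans le βs≤Fs

lemma4p2 : {U : Set} {El : U → Set}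
    (α β : Ord U El) (βs : List (Ord U El)) (γ : Ord U El) (γs : List (Ord U El)) →
    ((α ≤* (β ∷ βs)) → All (λ b → b ≤* (γ ∷ γs)) (β ∷ βs) → α ≤* (γ ∷ γs))
    × ((α <* (β ∷ βs)) → All (λ b → b ≤* (γ ∷ γs)) (β ∷ βs) → α <* (γ ∷ γs))
    × ((α ≤* (β ∷ βs)) → All (λ b → b <* (γ ∷ γs)) (β ∷ βs) → α <* (γ ∷ γs))
lemma4p2 α β βs γ γs =
  ≤*-trans , <*-≤*-trans , λ α≤βs βs<γs → ≤*-<*-trans {γs = γ ∷ γs} α≤βs (λ ()) βs<γs
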